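{- As $n\to+\infty$, $k(n)=o(n)$.
   Context: For $n\ge1$, $t(n)$ is the rooted planar tree of $n$: $t(1)$ is the single-vertex tree; if $n=p_1^{a_1}\cdots p_s^{a_s}$ with primes $p_1<\dots<p_s$, $a_i\ge1$, then $t(n)$ is a root with $s$ ordered edges, the $i$-th leading to a copy of $t(a_i)$. $t^\#(n)$ is the corresponding nonplanar rooted tree (forgetting the order of children). $k(n)=\max\{k\ge1: t^\#(n+1)=t^\#(n+2)=\cdots=t^\#(n+k)\}$. -}

module Defs where

open import Data.Nat using (ℕ; zero; suc; _+_; _*_; _≤_; _<_; _≟_; _≤?_)
open import Data.Nat.DivMod using (_/_; _%_)
open import Data.Nat.Primality using (prime?)
open import Data.List using (List; []; _∷_; map; filter; upTo)
open import Data.List.Relation.Binary.Permutation.Homogeneous using (Permutation)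
open import Relation.Nullary using (yes; no)
open import Data.Product using (_×_)

data Tree : Set where
  node : List Tree → Tree

-- Equality of the underlying nonplanar rooted trees (isomorphism of rooted
-- trees forgetting the order of children): children lists agree up to a
-- permutation, with corresponding children again isomorphic.
data _≅_ : Tree → Tree → Set where
  node : ∀ {xs ys} → Permutation _≅_ xs ys → node xs ≅ node ys

-- p-adic valuation of n (for p ≥ 2), computed with fuel f (fuel n suffices).
val : ℕ → ℕ → ℕ → ℕ
val zero p n = 0
val (suc f) zero n = 0
val (suc f) (suc zero) n = 0
val (suc f) (suc (suc q)) n with n ≟ 0
... | yes _ = 0
... | no _ with n % suc (suc q) ≟ 0
...   | yes _ = suc (val f (suc (suc q)) (n / suc (suc q)))
...   | no _ = 0

vp : ℕ → ℕ → ℕ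
vp p n = val n p n

-- The list of exponents a_1, ..., a_s of n = p_1^a_1 ... p_s^a_s, p_1 < ... < p_s
exps : ℕ → List ℕ
exps n = filter (λ a → 1 ≤? a) (map (λ p → vp p n) (filter prime? (upTo (suc n))))

-- t(n) computed with fuel; each exponent a_i of n satisfies a_i < n, so fuel n suffices.
tF : ℕ → ℕ → Tree
tF zero n = node []
tF (suc f) n = node (map (tF f) (exps n))

-- the rooted planar tree t(n) of n ≥ 1 (t(1) is the single-vertex tree)
t : ℕ → Tree
t n = tF n n

SameRun : ℕ → ℕ → Set
SameRun n k = ∀ i → i < k → t (n + suc i) ≅ t (n + 1)

IsK : ℕ → ℕ → Set
IsK n k = (1 ≤ k × SameRun n k) × (∀ k′ → 1 ≤ k′ → SameRun n k′ → k′ ≤ k)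

{-# OPTIONS --safe #-}

-- The tree of n has a vertex at depth 2 only if some exponent of n is at least 2, that is,
-- n has a square factor d² > 1.  This shape property is an isomorphism invariant and holds
-- for every n ≡ 4 (mod 8), so along a run of k ≥ 8 equal shapes all of n + 1, …, n + k
-- have square factors.
-- Counting multiples of d² in (n, n + k] for d ≤ √(n + k), with Σ_{d≥2} 1/d² ≤ 1/4 + 1/2
-- by telescoping, gives k ≤ 3k/4 + √(n + k), hence k = O(√n).

module Submission where

open import Defs
open import Data.Empty using (⊥; ⊥-elim)
open import Data.List using ([]; _∷_; _++_; map; filter; upTo)
open import Data.List.Membership.Propositional using (_∈_; find)
open import Data.List.Membership.Propositional.Properties using (∈-map⁺; ∈-map⁻; ∈-filter⁺; ∈-filter⁻; ∈-upTo⁺)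
import Data.List.Membership.Setoid.Properties as SetoidMembership
open import Data.List.Relation.Binary.Permutation.Homogeneous as Perm using (Permutation)
import Data.List.Relation.Binary.Permutation.Setoid.Properties as SetoidPermutation
open import Data.List.Relation.Binary.Pointwise.Base using (Pointwise; []; _∷_)
open import Data.List.Relation.Unary.All using (All; []; _∷_)
open import Data.List.Relation.Unary.Any as Any using (Any; here; any?)
open import Data.List.Relation.Unary.Any.Properties using (map⁺; map⁻)
open import Data.Nat
open import Data.Nat.DivMod
  using (_%_; _/_; m≡m%n+[m/n]*n; m%n<n; m*[n/m]≡n; m*n%n≡0; m*n/n≡m; [m+kn]%n≡m%n; m/n*n≤m; /-monoˡ-≤; m<n*o⇒m/o<n; m/n/o≡m/[n*o])
open import Data.Nat.Divisibility using (_∣_; divides; 1∣_; ∣-trans; ∣⇒≤; *-monoʳ-∣; m∣m*n; m%n≡0⇒n∣m)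
open import Data.Nat.Primality using (Prime; prime; prime?; prime[2])
open import Data.Nat.Properties
open import Data.Nat.Tactic.RingSolver using (solve-∀)
open import Data.Product using (Σ; ∃; _×_; _,_)
open import Data.Sum using (inj₁; inj₂; [_,_])
open import Data.Unit using (⊤; tt)
open import Function using (_∘_)
open import Relation.Binary.Bundles using (Setoid)
open import Relation.Binary.PropositionalEquality using (_≡_; _≢_; refl; sym; trans; cong; subst; module ≡-Reasoning)
open import Relation.Nullary using (Dec; yes; no; ¬_)

mutual
  ≅-refl : ∀ {x} → x ≅ x
  ≅-refl {node xs} = node (Perm.refl ≅-refl-pointwise)

  ≅-refl-pointwise : ∀ {xs} → Pointwise _≅_ xs xs
  ≅-refl-pointwise {[]}     = []
  ≅-refl-pointwise {x ∷ xs} = ≅-refl ∷ ≅-refl-pointwise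

mutual
  ≅-sym : ∀ {x y} → x ≅ y → y ≅ x
  ≅-sym (node p) = node (≅-sym-permutation p)

  ≅-sym-pointwise : ∀ {xs ys} → Pointwise _≅_ xs ys → Pointwise _≅_ ys xs
  ≅-sym-pointwise []       = []
  ≅-sym-pointwise (e ∷ es) = ≅-sym e ∷ ≅-sym-pointwise es

  ≅-sym-permutation : ∀ {xs ys} → Permutation _≅_ xs ys → Permutation _≅_ ys xs
  ≅-sym-permutation (Perm.refl es)    = Perm.refl (≅-sym-pointwise es)
  ≅-sym-permutation (Perm.prep e p)   = Perm.prep (≅-sym e) (≅-sym-permutation p)
  ≅-sym-permutation (Perm.swap e f p) = Perm.swap (≅-sym f) (≅-sym e) (≅-sym-permutation p)
  ≅-sym-permutation (Perm.trans p q)  = Perm.trans (≅-sym-permutation q) (≅-sym-permutation p)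

≅-trans : ∀ {x y z} → x ≅ y → y ≅ z → x ≅ z
≅-trans (node p) (node q) = node (Perm.trans p q)

≅-setoid : Setoid _ _
≅-setoid = record
  { Carrier       = Tree
  ; _≈_           = _≅_
  ; isEquivalence = record { refl = ≅-refl ; sym = ≅-sym ; trans = ≅-trans }
  }

open import Data.List.Relation.Binary.Permutation.Setoid ≅-setoid using (↭-refl; ↭-sym; ↭-trans)
open SetoidPermutation ≅-setoid
  using (↭-shift; ↭-respʳ-≋; ∈-resp-↭; Any-resp-↭; dropMiddleElement; xs↭ys⇒|xs|≡|ys|)
open import Data.List.Relation.Binary.Equality.Setoid ≅-setoid using (≋-sym)

[]≭∷ : ∀ {x xs} → ¬ Permutation _≅_ [] (x ∷ xs)
[]≭∷ p with xs↭ys⇒|xs|≡|ys| p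
... | ()

-- The deciders for the children of the left tree are passed in through All, which keeps
-- the mutual recursion with _≅?_ structural.
permutation? : ∀ xs ys → All (λ x → ∀ y → Dec (x ≅ y)) xs → Dec (Permutation _≅_ xs ys)
permutation? []       []       _ = yes (Perm.refl [])
permutation? []       (y ∷ ys) _ = no []≭∷
permutation? (x ∷ xs) ys (x≅? ∷ xs≅?) with any? x≅? ys
... | no x∉ys = no λ p → x∉ys (∈-resp-↭ p (here ≅-refl))
... | yes x∈ys with SetoidMembership.∈-∃++ ≅-setoid x∈ys
...   | as , bs , w , x≅w , ys≋ with permutation? xs (as ++ bs) xs≅?
...     | yes p = yes (↭-respʳ-≋ (≋-sym ys≋) (↭-trans (Perm.prep x≅w p) (↭-sym (↭-shift as bs))))
...     | no ¬p = no λ q → ¬p (dropMiddleElement [] as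
                    (↭-trans (Perm.prep (≅-sym x≅w) ↭-refl) (↭-respʳ-≋ ys≋ q)))

mutual
  _≅?_ : ∀ x y → Dec (x ≅ y)
  node xs ≅? node ys with permutation? xs ys (all-≅? xs)
  ... | yes p = yes (node p)
  ... | no ¬p = no λ { (node p) → ¬p p }

  all-≅? : ∀ xs → All (λ x → ∀ y → Dec (x ≅ y)) xs
  all-≅? []       = []
  all-≅? (x ∷ xs) = (x ≅?_) ∷ all-≅? xs

HasChild : Tree → Set
HasChild (node [])      = ⊥
HasChild (node (_ ∷ _)) = ⊤

HasGrandchild : Tree → Set
HasGrandchild (node xs) = Any HasChild xs

hasChild-resp-≅ : ∀ {x y} → x ≅ y → HasChild x → HasChild y
hasChild-resp-≅ {node (_ ∷ _)} {node []}      (node p) _ = []≭∷ (≅-sym-permutation p)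
hasChild-resp-≅ {node (_ ∷ _)} {node (_ ∷ _)} _        _ = tt

hasGrandchild-resp-≅ : ∀ {x y} → x ≅ y → HasGrandchild x → HasGrandchild y
hasGrandchild-resp-≅ (node p) = Any-resp-↭ hasChild-resp-≅ p

p^val∣ : ∀ f p n → p ^ val f p n ∣ n
p^val∣ zero    _             n = 1∣ n
p^val∣ (suc f) zero          n = 1∣ n
p^val∣ (suc f) (suc zero)    n = 1∣ n
p^val∣ (suc f) p@(suc (suc _)) n with n ≟ 0
... | yes _ = 1∣ n
... | no _ with n % p ≟ 0
...   | no _       = 1∣ n
...   | yes n%p≡0 = subst (p * p ^ val f p (n / p) ∣_) (m*[n/m]≡n (m%n≡0⇒n∣m n p n%p≡0))
                      (*-monoʳ-∣ p (p^val∣ f p (n / p)))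

val-suc*p : ∀ f q c → val (suc f) (2 + q) (suc c * (2 + q)) ≡ suc (val f (2 + q) (suc c))
val-suc*p f q c with suc c * (2 + q) ≟ 0
... | yes ()
... | no _ with suc c * (2 + q) % (2 + q) ≟ 0
...   | no p∤ = ⊥-elim (p∤ (m*n%n≡0 (suc c) (2 + q)))
...   | yes _ = cong (λ m → suc (val f (2 + q) m)) (m*n/n≡m (suc c) (2 + q))

val-indivisible : ∀ f q n → n % (2 + q) ≢ 0 → val (suc f) (2 + q) n ≡ 0
val-indivisible f q n p∤n with n ≟ 0
... | yes _ = refl
... | no _ with n % (2 + q) ≟ 0
...   | yes p∣n = ⊥-elim (p∤n p∣n)
...   | no _    = refl

-- Written (1 + 2q)·2·2 rather than 8q + 4 so that both the number and the fuel of vp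
-- unfold to the successor forms val-suc*p matches on.
vp-2-of-4*odd : ∀ q → vp 2 ((1 + q * 2) * 2 * 2) ≡ 2
vp-2-of-4*odd q = begin
  val (4 + r) 2 (suc (suc (q * 2 * 2)) * 2) ≡⟨ val-suc*p (3 + r) 0 (suc (q * 2 * 2)) ⟩
  suc (val (3 + r) 2 (suc (q * 2) * 2))     ≡⟨ cong suc (val-suc*p (2 + r) 0 (q * 2)) ⟩
  suc (suc (val (2 + r) 2 (1 + q * 2)))     ≡⟨ cong (λ v → suc (suc v)) (val-indivisible _ 0 (1 + q * 2) odd) ⟩
  2                                          ∎
  where
  open ≡-Reasoning
  r = q * 2 * 2 * 2
  odd : (1 + q * 2) % 2 ≢ 0
  odd 1+2q%2≡0 with trans (sym ([m+kn]%n≡m%n 1 q 2)) 1+2q%2≡0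
  ... | ()

∈-exps⁻ : ∀ {a n} → a ∈ exps n → ∃ λ p → Prime p × a ≡ vp p n
∈-exps⁻ {n = n} a∈ with ∈-filter⁻ (1 ≤?_) {xs = map (λ p → vp p n) (filter prime? (upTo (suc n)))} a∈
... | a∈vps , _ with ∈-map⁻ (λ p → vp p n) a∈vps
...   | p , p∈primes , a≡vp with ∈-filter⁻ prime? {xs = upTo (suc n)} p∈primes
...     | _ , p-prime = p , p-prime , a≡vp

∈-exps⁺ : ∀ {p n} → Prime p → p ≤ n → 1 ≤ vp p n → vp p n ∈ exps n
∈-exps⁺ {n = n} p-prime p≤n 1≤vp =
  ∈-filter⁺ (1 ≤?_) (∈-map⁺ (λ p → vp p n) (∈-filter⁺ prime? (∈-upTo⁺ (s≤s p≤n)) p-prime)) 1≤vp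

HasSquareFactor : ℕ → Set
HasSquareFactor n = ∃ λ d → 2 ≤ d × d * d ∣ n

p*p∣p^[2+a] : ∀ p a → p * p ∣ p ^ (2 + a)
p*p∣p^[2+a] p a = *-monoʳ-∣ p (m∣m*n (p ^ a))

hasChild-tF⇒2≤ : ∀ f a → HasChild (tF f a) → 2 ≤ a
hasChild-tF⇒2≤ (suc f) (suc (suc a)) _ = s≤s (s≤s z≤n)

hasGrandchild⇒hasSquareFactor : ∀ n → HasGrandchild (t n) → HasSquareFactor n
hasGrandchild⇒hasSquareFactor (suc n) child-with-child
  with find (map⁻ child-with-child)
... | a , a∈exps , hasChild with ∈-exps⁻ {n = suc n} a∈exps | hasChild-tF⇒2≤ n a hasChild
...   | p , prime {{p>1}} _ , a≡vp | s≤s (s≤s {n = b} _) =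
  p , nonTrivial⇒n>1 p {{p>1}} ,
  ∣-trans (p*p∣p^[2+a] p b) (subst (λ e → p ^ e ∣ suc n) (sym a≡vp) (p^val∣ (suc n) p (suc n)))

2∈exps⇒hasGrandchild : ∀ n → 2 ∈ exps n → HasGrandchild (t n)
2∈exps⇒hasGrandchild (suc (suc n)) 2∈exps = map⁺ (Any.map (λ { refl → tt }) 2∈exps)

hasGrandchild-4*odd : ∀ q → HasGrandchild (t ((1 + q * 2) * 2 * 2))
hasGrandchild-4*odd q = 2∈exps⇒hasGrandchild n (subst (_∈ exps n) vp≡2 (∈-exps⁺ prime[2] (s≤s (s≤s z≤n)) 1≤vp))
  where
  n = (1 + q * 2) * 2 * 2
  vp≡2 : vp 2 n ≡ 2
  vp≡2 = vp-2-of-4*odd q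
  1≤vp : 1 ≤ vp 2 n
  1≤vp = subst (1 ≤_) (sym vp≡2) (s≤s z≤n)

-- The number of pairs (d, y) with 2 ≤ d ≤ j + 1, 1 ≤ y ≤ x and d² ∣ y.
squareMultiples : ℕ → ℕ → ℕ
squareMultiples zero    x = 0
squareMultiples (suc j) x = squareMultiples j x + x / ((2 + j) * (2 + j))

squareMultiples-monoʳ : ∀ j {x y} → x ≤ y → squareMultiples j x ≤ squareMultiples j y
squareMultiples-monoʳ zero    _   = z≤n
squareMultiples-monoʳ (suc j) x≤y =
  +-mono-≤ (squareMultiples-monoʳ j x≤y) (/-monoˡ-≤ ((2 + j) * (2 + j)) x≤y)

d∣1+n⇒n/d<[1+n]/d : ∀ n d .{{_ : NonZero d}} → d ∣ suc n → n / d < suc n / d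
d∣1+n⇒n/d<[1+n]/d n d (divides c 1+n≡c*d) = begin-strict
  n / d         <⟨ m<n*o⇒m/o<n (subst (n <_) 1+n≡c*d (n<1+n n)) ⟩
  c             ≡⟨ sym (m*n/n≡m c d) ⟩
  c * d / d     ≡⟨ cong (_/ d) (sym 1+n≡c*d) ⟩
  suc n / d     ∎
  where open ≤-Reasoning

squareMultiples-step : ∀ j {x d} → 2 ≤ d → d ≤ suc j → d * d ∣ suc x →
                       squareMultiples j x < squareMultiples j (suc x)
squareMultiples-step zero    (s≤s (s≤s _)) (s≤s ())
squareMultiples-step (suc j) {x} 2≤d d≤2+j d*d∣1+x with m≤n⇒m<n∨m≡n d≤2+j
... | inj₁ (s≤s d≤1+j) = +-mono-<-≤ (squareMultiples-step j 2≤d d≤1+j d*d∣1+x)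
                                    (/-monoˡ-≤ ((2 + j) * (2 + j)) (n≤1+n x))
... | inj₂ refl        = +-mono-≤-< (squareMultiples-monoʳ j (n≤1+n x))
                                    (d∣1+n⇒n/d<[1+n]/d x ((2 + j) * (2 + j)) d*d∣1+x)

m*m<n*n⇒m<n : ∀ {m n} → m * m < n * n → m < n
m*m<n*n⇒m<n m*m<n*n = ≰⇒> λ n≤m → <⇒≱ m*m<n*n (*-mono-≤ n≤m n≤m)

squareMultiples-run : ∀ j a L → a + L < suc j * suc j →
                      (∀ i → i < L → HasSquareFactor (a + suc i)) →
                      squareMultiples j a + L ≤ squareMultiples j (a + L)
squareMultiples-run j a zero    _     _        =
  ≤-trans (≤-reflexive (+-identityʳ _)) (squareMultiples-monoʳ j (m≤m+n a 0))
squareMultiples-run j a (suc L) bound squareful with squareful L ≤-refl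
... | d , 2≤d , d*d∣a+1+L = begin
  squareMultiples j a + suc L      ≡⟨ +-suc (squareMultiples j a) L ⟩
  suc (squareMultiples j a + L)    ≤⟨ s≤s (squareMultiples-run j a L (<-trans (+-monoʳ-< a (n<1+n L)) bound)
                                             (λ i i<L → squareful i (m≤n⇒m≤1+n i<L))) ⟩
  suc (squareMultiples j (a + L))  ≤⟨ squareMultiples-step j 2≤d (<⇒≤ d<1+j) d*d∣1+a+L ⟩
  squareMultiples j (suc (a + L))  ≡⟨ cong (squareMultiples j) (sym (+-suc a L)) ⟩
  squareMultiples j (a + suc L)    ∎
  where
  open ≤-Reasoning
  d*d∣1+a+L : d * d ∣ suc (a + L)
  d*d∣1+a+L = subst (d * d ∣_) (+-suc a L) d*d∣a+1+L
  d<1+j : d < suc j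
  d<1+j = m*m<n*n⇒m<n (≤-<-trans (∣⇒≤ d*d∣1+a+L) (subst (_< suc j * suc j) (+-suc a L) bound))

m<[1+m/d]*d : ∀ m d .{{_ : NonZero d}} → m < suc (m / d) * d
m<[1+m/d]*d m d = begin-strict
  m                  ≡⟨ m≡m%n+[m/n]*n m d ⟩
  m % d + m / d * d  <⟨ +-monoˡ-< (m / d * d) (m%n<n m d) ⟩
  d + m / d * d      ∎
  where open ≤-Reasoning

[m+n]/d≤m/d+[1+n/d] : ∀ m n d .{{_ : NonZero d}} → (m + n) / d ≤ m / d + suc (n / d)
[m+n]/d≤m/d+[1+n/d] m n d = m<1+n⇒m≤n (m<n*o⇒m/o<n (begin-strict
  m + n                                  <⟨ +-mono-< (m<[1+m/d]*d m d) (m<[1+m/d]*d n d) ⟩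
  suc (m / d) * d + suc (n / d) * d      ≡⟨ sym (*-distribʳ-+ d (suc (m / d)) (suc (n / d))) ⟩
  suc (m / d + suc (n / d)) * d          ∎))
  where open ≤-Reasoning

squareMultiples-subadditive : ∀ j a b →
  squareMultiples j (a + b) ≤ squareMultiples j a + squareMultiples j b + j
squareMultiples-subadditive zero    a b = z≤n
squareMultiples-subadditive (suc j) a b = begin
  squareMultiples j (a + b) + (a + b) / q
    ≤⟨ +-mono-≤ (squareMultiples-subadditive j a b) ([m+n]/d≤m/d+[1+n/d] a b q) ⟩
  (squareMultiples j a + squareMultiples j b + j) + (a / q + suc (b / q))
    ≡⟨ regroup (squareMultiples j a) (squareMultiples j b) j (a / q) (b / q) ⟩
  (squareMultiples j a + a / q) + (squareMultiples j b + b / q) + suc j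
    ∎
  where
  open ≤-Reasoning
  q = (2 + j) * (2 + j)
  regroup : ∀ u v w x y → (u + v + w) + (x + suc y) ≡ (u + x) + (v + y) + suc w
  regroup = solve-∀

m*n≤o⇒m≤o/n : ∀ m n o .{{_ : NonZero n}} → m * n ≤ o → m ≤ o / n
m*n≤o⇒m≤o/n m n o m*n≤o = subst (_≤ o / n) (m*n/n≡m m n) (/-monoˡ-≤ n m*n≤o)

-- Discrete form of 1/d² + 1/d ≤ 1/(d - 1).
n/[d*d]+n/d≤n/[d∸1] : ∀ n e → n / ((2 + e) * (2 + e)) + n / (2 + e) ≤ n / (1 + e)
n/[d*d]+n/d≤n/[d∸1] n e = m*n≤o⇒m≤o/n (u + v) (1 + e) n (begin
  (u + v) * (1 + e)          ≡⟨ *-distribʳ-+ (1 + e) u v ⟩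
  u * (1 + e) + v * (1 + e)  ≤⟨ +-monoˡ-≤ (v * (1 + e)) u*[1+e]≤v ⟩
  v + v * (1 + e)            ≡⟨ sym (*-suc v (1 + e)) ⟩
  v * d                      ≤⟨ m/n*n≤m n d ⟩
  n                          ∎)
  where
  open ≤-Reasoning
  d = 2 + e
  v = n / d
  u = n / (d * d)
  u*[1+e]≤v : u * (1 + e) ≤ v
  u*[1+e]≤v = begin
    u * (1 + e)  ≤⟨ *-monoʳ-≤ u (n≤1+n (1 + e)) ⟩
    u * d        ≡⟨ cong (_* d) (sym (m/n/o≡m/[n*o] n d d)) ⟩
    v / d * d    ≤⟨ m/n*n≤m v d ⟩
    v            ∎

squareMultiples-telescope : ∀ j n → squareMultiples (suc j) n + n / (2 + j) ≤ n / 4 + n / 2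
squareMultiples-telescope zero    n = ≤-refl
squareMultiples-telescope (suc j) n = begin
  squareMultiples (suc j) n + n / ((3 + j) * (3 + j)) + n / (3 + j)
    ≡⟨ +-assoc (squareMultiples (suc j) n) _ _ ⟩
  squareMultiples (suc j) n + (n / ((3 + j) * (3 + j)) + n / (3 + j))
    ≤⟨ +-monoʳ-≤ (squareMultiples (suc j) n) (n/[d*d]+n/d≤n/[d∸1] n (suc j)) ⟩
  squareMultiples (suc j) n + n / (2 + j)
    ≤⟨ squareMultiples-telescope j n ⟩
  n / 4 + n / 2
    ∎
  where open ≤-Reasoning

squareMultiples≤n/4+n/2 : ∀ j n → squareMultiples j n ≤ n / 4 + n / 2
squareMultiples≤n/4+n/2 zero    n = z≤n
squareMultiples≤n/4+n/2 (suc j) n =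
  ≤-trans (m≤m+n (squareMultiples (suc j) n) (n / (2 + j))) (squareMultiples-telescope j n)

squarefulRun⇒L≤L/4+L/2+j : ∀ j a L → a + L < suc j * suc j →
                         (∀ i → i < L → HasSquareFactor (a + suc i)) →
                         L ≤ L / 4 + L / 2 + j
squarefulRun⇒L≤L/4+L/2+j j a L bound squareful = begin
  L                                         ≤⟨ +-cancelˡ-≤ (squareMultiples j a) L _ run ⟩
  squareMultiples j L + j                   ≤⟨ +-monoˡ-≤ j (squareMultiples≤n/4+n/2 j L) ⟩
  L / 4 + L / 2 + j                         ∎
  where
  open ≤-Reasoning
  run : squareMultiples j a + L ≤ squareMultiples j a + (squareMultiples j L + j)
  run = begin
    squareMultiples j a + L                               ≤⟨ squareMultiples-run j a L bound squareful ⟩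
    squareMultiples j (a + L)                             ≤⟨ squareMultiples-subadditive j a L ⟩
    squareMultiples j a + squareMultiples j L + j         ≡⟨ +-assoc (squareMultiples j a) _ j ⟩
    squareMultiples j a + (squareMultiples j L + j)       ∎

n/4+n/2+n/8<n : ∀ n .{{_ : NonZero n}} → n / 4 + n / 2 + n / 8 < n
n/4+n/2+n/8<n n = *-cancelˡ-< 8 _ n (begin-strict
  8 * (n / 4 + n / 2 + n / 8)                 ≡⟨ scale (n / 4) (n / 2) (n / 8) ⟩
  n / 4 * 4 * 2 + n / 2 * 2 * 4 + n / 8 * 8   ≤⟨ +-mono-≤ (+-mono-≤ (*-monoˡ-≤ 2 (m/n*n≤m n 4))
                                                                   (*-monoˡ-≤ 4 (m/n*n≤m n 2)))
                                                         (m/n*n≤m n 8) ⟩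
  n * 2 + n * 4 + n                           ≡⟨ seven n ⟩
  7 * n                                       <⟨ *-monoˡ-< n (n<1+n 7) ⟩
  8 * n                                       ∎)
  where
  open ≤-Reasoning
  scale : ∀ x y z → 8 * (x + y + z) ≡ x * 4 * 2 + y * 2 * 4 + z * 8
  scale = solve-∀
  seven : ∀ n → n * 2 + n * 4 + n ≡ 7 * n
  seven = solve-∀

n+L<[1+L/8]² : ∀ m n L → 64 * suc m ≤ L → n < m * L → n + L < suc (L / 8) * suc (L / 8)
n+L<[1+L/8]² m n L 64[1+m]≤L n<m*L = *-cancelʳ-< 64 (n + L) (suc j * suc j) (begin-strict
  (n + L) * 64                   <⟨ *-monoˡ-< 64 (+-monoˡ-< L n<m*L) ⟩
  (m * L + L) * 64               ≡⟨ regroup m L ⟩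
  64 * suc m * L                 ≤⟨ *-monoˡ-≤ L 64[1+m]≤L ⟩
  L * L                          <⟨ *-mono-< (m<[1+m/d]*d L 8) (m<[1+m/d]*d L 8) ⟩
  suc j * 8 * (suc j * 8)        ≡⟨ square-of-8× (suc j) ⟩
  suc j * suc j * 64             ∎)
  where
  open ≤-Reasoning
  j = L / 8
  regroup : ∀ m L → (m * L + L) * 64 ≡ 64 * suc m * L
  regroup = solve-∀
  square-of-8× : ∀ x → x * 8 * (x * 8) ≡ x * x * 64
  square-of-8× = solve-∀

-- With j = ⌊L/8⌋ the run lies below (j + 1)², so L ≤ L/4 + L/2 + L/8 < L.
squarefulRun-bound : ∀ m n L → 64 * suc m ≤ L →
                     (∀ i → i < L → HasSquareFactor (n + suc i)) → m * L ≤ n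
squarefulRun-bound m n L 64[1+m]≤L squareful with m * L ≤? n
... | yes m*L≤n = m*L≤n
... | no m*L≰n  = ⊥-elim (<⇒≱ (n/4+n/2+n/8<n L {{>-nonZero (≤-trans (s≤s z≤n) 64[1+m]≤L)}})
                              (squarefulRun⇒L≤L/4+L/2+j (L / 8) n L bound squareful))
  where
  bound : n + L < suc (L / 8) * suc (L / 8)
  bound = n+L<[1+L/8]² m n L 64[1+m]≤L (≰⇒> m*L≰n)

4*odd-within-8 : ∀ n → ∃ λ i → i < 8 × ∃ λ q → n + suc i ≡ (1 + q * 2) * 2 * 2
4*odd-within-8 n = 7 ∸ r , s≤s (m∸n≤m 7 r) , q , +-cancelʳ-≡ r _ _ (begin
  n + suc (7 ∸ r) + r       ≡⟨ +-assoc n (suc (7 ∸ r)) r ⟩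
  n + suc (7 ∸ r + r)       ≡⟨ cong (λ x → n + suc x) (m∸n+n≡m r≤7) ⟩
  n + 8                     ≡⟨ +-assoc n 4 4 ⟨
  n + 4 + 4                 ≡⟨ cong (_+ 4) (m≡m%n+[m/n]*n (n + 4) 8) ⟩
  r + q * 8 + 4             ≡⟨ regroup r q ⟩
  (1 + q * 2) * 2 * 2 + r   ∎)
  where
  open ≡-Reasoning
  r = (n + 4) % 8
  q = (n + 4) / 8
  r≤7 : r ≤ 7
  r≤7 = m<1+n⇒m≤n (m%n<n (n + 4) 8)
  regroup : ∀ r q → r + q * 8 + 4 ≡ (1 + q * 2) * 2 * 2 + r
  regroup = solve-∀

longSameRun⇒squareful : ∀ n k → 8 ≤ k → SameRun n k → ∀ i → i < k → HasSquareFactor (n + suc i)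
longSameRun⇒squareful n k 8≤k run i i<k with 4*odd-within-8 n
... | i₀ , i₀<8 , q , n+1+i₀≡4*odd = hasGrandchild⇒hasSquareFactor (n + suc i)
  (hasGrandchild-resp-≅ (≅-trans (run i₀ (<-≤-trans i₀<8 8≤k)) (≅-sym (run i i<k)))
    (subst (HasGrandchild ∘ t) (sym n+1+i₀≡4*odd) (hasGrandchild-4*odd q)))

sameRun-bound : ∀ m n k → m * (64 * suc m) ≤ n → SameRun n k → m * k ≤ n
sameRun-bound m n k N≤n run with k ≤? 64 * suc m
... | yes k≤64[1+m] = ≤-trans (*-monoʳ-≤ m k≤64[1+m]) N≤n
... | no k≰64[1+m]  = squarefulRun-bound m n k 64[1+m]≤k (longSameRun⇒squareful n k 8≤k run)
  where
  64[1+m]≤k : 64 * suc m ≤ k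
  64[1+m]≤k = <⇒≤ (≰⇒> k≰64[1+m])
  8≤k : 8 ≤ k
  8≤k = ≤-trans (m≤m+n 8 56) (≤-trans (m≤m*n 64 (suc m)) 64[1+m]≤k)

module _ {P : ℕ → Set} (P? : ∀ i → Dec (P i)) where

  least-failure : ∀ B → ¬ (∀ i → i < B → P i) → ∃ λ i → ¬ P i × (∀ j → j < i → P j)
  least-failure zero    ¬all = ⊥-elim (¬all λ _ ())
  least-failure (suc B) ¬all with allUpTo? P? B
  ... | no ¬all<B = least-failure B λ all<B → ¬all<B (all<B _)
  ... | yes all<B = B , ¬PB , λ j j<B → all<B j<B
    where
    ¬PB : ¬ P B
    ¬PB PB = ¬all λ i i<1+B → [ all<B , (λ i≡B → subst P (sym i≡B) PB) ] (m<1+n⇒m<n∨m≡n i<1+B)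

firstBreak⇒IsK : ∀ n k → ¬ (t (n + suc k) ≅ t (n + 1)) → SameRun n k → IsK n k
firstBreak⇒IsK n zero    break _   = ⊥-elim (break ≅-refl)
firstBreak⇒IsK n (suc k) break run = (s≤s z≤n , run) , maximal
  where
  maximal : ∀ k′ → 1 ≤ k′ → SameRun n k′ → k′ ≤ suc k
  maximal k′ _ run′ with k′ ≤? suc k
  ... | yes k′≤1+k = k′≤1+k
  ... | no k′≰1+k  = ⊥-elim (break (run′ (suc k) (≰⇒> k′≰1+k)))

lemma6 : ∀ (m : ℕ) → 1 ≤ m → Σ ℕ λ N → ∀ (n : ℕ) → n ≥ N → Σ ℕ λ k → IsK n k × m * k ≤ n
lemma6 m 1≤m = m * (64 * suc m) , k-exists
  where
  k-exists : ∀ n → n ≥ m * (64 * suc m) → Σ ℕ λ k → IsK n k × m * k ≤ n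
  k-exists n N≤n with least-failure (λ i → t (n + suc i) ≅? t (n + 1)) (suc n) no-run-beyond-n
    where
    no-run-beyond-n : ¬ SameRun n (suc n)
    no-run-beyond-n run =
      1+n≰n (≤-trans (m≤n*m (suc n) m {{>-nonZero 1≤m}}) (sameRun-bound m n (suc n) N≤n run))
  ... | k , break , run = k , firstBreak⇒IsK n k break run , sameRun-bound m n k N≤n run
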